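{- Let $G$ be the group of isometries of $\mathbb{R}^2$ generated by the quarter turn about the origin and the translations by the lattice $\Lambda=\mathbb{Z}(2,1)+\mathbb{Z}(-1,2)$ (this is the isometry group $G_2$ of the $(5,3)$ satin with $M_1=2$, $N_1=1$, coordinates chosen with a quarter-turn centre at the origin; its quarter-turn centres are $\Lambda\cup\big((\tfrac12,\tfrac32)+\Lambda\big)$). Let $m,n$ be integers of opposite parity, and put $M'_1=2m-n$, $N'_1=m+2n$. Let $a_1=(M'_1,N'_1)$, $b_1=(-N'_1,M'_1)$, and for $k=1,2,3$ let $a_{k+1}=a_k+b_k$, $b_{k+1}=b_k-a_k$. Let $c=\tfrac12(a_1+b_1)$. For $k=1,2,3,4$ let $G'_k$ be the group generated by the quarter turn about $c$ and the translations by $\mathbb{Z}a_k+\mathbb{Z}b_k$ (the isometry group at level $k$ based on the level-1 square with corners $0,a_1,a_1+b_1,b_1$). Then $G'_k$ is a subgroup of $G$ for each $k=1,2,3,4$.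
   Context: The squares with side vectors $a_k,b_k$ form a nested family: the level-1 square has corners $0,a_1,a_1+b_1,b_1$ and centre $c$; for each $k$ the level-$(k+1)$ square has the same centre $c$ and escribes the level-$k$ square (the corners of the level-$k$ square are the midpoints of the sides of the level-$(k+1)$ square). In the paper, $G'_k$ is described as the group $G_2$ (isometric parts of symmetries) at level $k$ based on the level-1 lattice unit with leg lengths $M'_1, N'_1$; it has quarter-turn centres at the corners and centres of the level-$k$ squares. -}

module Defs where

open import Data.Nat as ℕ using (ℕ; zero; suc)
open import Data.Integer using (ℤ; +_; -_; _+_; _-_; _*_)
open import Data.Product using (Σ; _×_; _,_; ∃-syntax)
open import Relation.Binary.PropositionalEquality using (_≡_)

-- Points/vectors of the plane with coordinates in ½ℤ, represented by their
-- DOUBLED coordinates: the pair (X , Y) denotes the point (X/2 , Y/2).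
-- Every point occurring in the statement (lattice vectors, the centre c)
-- lies in ½ℤ², and all isometries generated map ½ℤ² to itself.
V : Set
V = ℤ × ℤ

_⊕_ : V → V → V
(x , y) ⊕ (x' , y') = (x + x') , (y + y')

_⊖_ : V → V → V
(x , y) ⊖ (x' , y') = (x - x') , (y - y')

⊝_ : V → V
⊝ (x , y) = (- x) , (- y)

_·_ : ℤ → V → V
k · (x , y) = (k * x) , (k * y)

dbl : ℤ → ℤ → V
dbl x y = (+ 2 * x) , (+ 2 * y)

data Rot : Set where
  r0 r1 r2 r3 : Rot

_∘ʳ_ : Rot → Rot → Rot
r0 ∘ʳ s  = s
r1 ∘ʳ r0 = r1
r1 ∘ʳ r1 = r2
r1 ∘ʳ r2 = r3
r1 ∘ʳ r3 = r0
r2 ∘ʳ r0 = r2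
r2 ∘ʳ r1 = r3
r2 ∘ʳ r2 = r0
r2 ∘ʳ r3 = r1
r3 ∘ʳ r0 = r3
r3 ∘ʳ r1 = r0
r3 ∘ʳ r2 = r1
r3 ∘ʳ r3 = r2

invʳ : Rot → Rot
invʳ r0 = r0
invʳ r1 = r3
invʳ r2 = r2
invʳ r3 = r1

rotate : Rot → V → V
rotate r0 (x , y) = x , y
rotate r1 (x , y) = (- y) , x
rotate r2 (x , y) = (- x) , (- y)
rotate r3 (x , y) = y , (- x)

-- This representation
-- is canonical: two such records are equal iff the isometries are equal.
record Iso : Set where
  constructor iso
  field
    rot : Rot
    tr  : V

open Iso public

apply : Iso → V → V
apply (iso r t) p = rotate r p ⊕ t

_∘ᵢ_ : Iso → Iso → Iso
iso r t ∘ᵢ iso s u = iso (r ∘ʳ s) (rotate r u ⊕ t)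

idᵢ : Iso
idᵢ = iso r0 (+ 0 , + 0)

invᵢ : Iso → Iso
invᵢ (iso r t) = iso (invʳ r) (⊝ rotate (invʳ r) t)

-- quarter turn (counterclockwise) about the point p:  x ↦ R(x - p) + p
quarterTurn : V → Iso
quarterTurn p = iso r1 (p ⊖ rotate r1 p)

translation : V → Iso
translation v = iso r0 v

data ⟨_⟩ (S : Iso → Set) : Iso → Set where
  gen : ∀ {g} → S g → ⟨ S ⟩ g
  one : ⟨ S ⟩ idᵢ
  mul : ∀ {g h} → ⟨ S ⟩ g → ⟨ S ⟩ h → ⟨ S ⟩ (g ∘ᵢ h)
  inv : ∀ {g} → ⟨ S ⟩ g → ⟨ S ⟩ (invᵢ g)

data QTLatticeGens (p u w : V) : Iso → Set where
  qt  : QTLatticeGens p u w (quarterTurn p)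
  trn : (i j : ℤ) → QTLatticeGens p u w (translation ((i · u) ⊕ (j · w)))

G : Iso → Set
G = ⟨ QTLatticeGens (+ 0 , + 0) (dbl (+ 2) (+ 1)) (dbl (- + 1) (+ 2)) ⟩

M'₁ N'₁ : ℤ → ℤ → ℤ
M'₁ m n = + 2 * m - n
N'₁ m n = m + + 2 * n

-- level-k side vectors (a_k , b_k), doubled; level 0 is unused (set to level 1)
level : ℤ → ℤ → ℕ → V × V
level m n zero = dbl (M'₁ m n) (N'₁ m n) , dbl (- N'₁ m n) (M'₁ m n)
level m n (suc zero) = dbl (M'₁ m n) (N'₁ m n) , dbl (- N'₁ m n) (M'₁ m n)
level m n (suc (suc k)) with level m n (suc k)
... | (a , b) = (a ⊕ b) , (b ⊖ a)

aₖ bₖ : ℤ → ℤ → ℕ → V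
aₖ m n k = Data.Product.proj₁ (level m n k)
bₖ m n k = Data.Product.proj₂ (level m n k)

-- centre c = (a_1 + b_1)/2; in doubled coordinates this is a_1 + b_1 (undoubled)
centre : ℤ → ℤ → V
centre m n = (M'₁ m n - N'₁ m n) , (N'₁ m n + M'₁ m n)

G' : ℤ → ℤ → ℕ → Iso → Set
G' m n k = ⟨ QTLatticeGens (centre m n) (aₖ m n k) (bₖ m n k) ⟩

{-# OPTIONS --safe #-}
module Submission where

-- Both a₁ = m(2,1) + n(-1,2) and b₁ = -n(2,1) + m(-1,2) lie in Λ = ℤ(2,1) + ℤ(-1,2), and
-- a_{k+1}, b_{k+1} are integer combinations of a_k, b_k, so every level-k lattice lies in Λ.
-- The quarter turn about c = (a₁ + b₁)/2 is x ↦ Rx + a₁, i.e. the quarter turn about 0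
-- followed by a translation in Λ.

open import Defs
open import Data.Nat using (ℕ; zero; suc; _≤_)
open import Data.Integer using (ℤ; +_; _+_; _-_; _*_; -_)
open import Data.Integer.Divisibility using (_∣_)
open import Data.Integer.Properties using (+-identityˡ)
open import Data.Integer.Tactic.RingSolver using (solve-∀)
open import Data.Product using (_×_; _,_; ∃-syntax)
open import Relation.Nullary using (¬_)
open import Relation.Binary.PropositionalEquality using (_≡_; refl; cong; cong₂; subst; sym)

⟨⟩-least : ∀ {S T : Iso → Set} → (∀ {g} → S g → ⟨ T ⟩ g) → ∀ {g} → ⟨ S ⟩ g → ⟨ T ⟩ g
⟨⟩-least S⊆T (gen s)   = S⊆T s
⟨⟩-least S⊆T one       = one
⟨⟩-least S⊆T (mul g h) = mul (⟨⟩-least S⊆T g) (⟨⟩-least S⊆T h)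
⟨⟩-least S⊆T (inv g)   = inv (⟨⟩-least S⊆T g)

Span : V → V → V → Set
Span u w v = ∃[ p ] ∃[ q ] v ≡ (p · u) ⊕ (q · w)

module _ {u w : V} where

  Span-⊕ : ∀ {v v'} → Span u w v → Span u w v' → Span u w (v ⊕ v')
  Span-⊕ (p , q , refl) (p' , q' , refl) =
    p + p' , q + q' , cong₂ _,_ (+-distrib p q p' q' _ _) (+-distrib p q p' q' _ _)
    where
    +-distrib : ∀ p q p' q' x y → (p * x + q * y) + (p' * x + q' * y) ≡ (p + p') * x + (q + q') * y
    +-distrib = solve-∀

  Span-⊖ : ∀ {v v'} → Span u w v → Span u w v' → Span u w (v ⊖ v')
  Span-⊖ (p , q , refl) (p' , q' , refl) =
    p - p' , q - q' , cong₂ _,_ (-‿distrib p q p' q' _ _) (-‿distrib p q p' q' _ _)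
    where
    -‿distrib : ∀ p q p' q' x y → (p * x + q * y) - (p' * x + q' * y) ≡ (p - p') * x + (q - q') * y
    -‿distrib = solve-∀

  Span-· : ∀ i {v} → Span u w v → Span u w (i · v)
  Span-· i (p , q , refl) = i * p , i * q , cong₂ _,_ (*-distrib i p q _ _) (*-distrib i p q _ _)
    where
    *-distrib : ∀ i p q x y → i * (p * x + q * y) ≡ (i * p) * x + (i * q) * y
    *-distrib = solve-∀

Λ : V → Set
Λ = Span (dbl (+ 2) (+ 1)) (dbl (- + 1) (+ 2))

Λ-a₁ : ∀ m n → Λ (aₖ m n 1)
Λ-a₁ m n = m , n , cong₂ _,_ (x m n) (y m n)
  where
  x : ∀ m n → + 2 * (+ 2 * m - n) ≡ m * (+ 2 * + 2) + n * (+ 2 * - + 1)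
  x = solve-∀
  y : ∀ m n → + 2 * (m + + 2 * n) ≡ m * (+ 2 * + 1) + n * (+ 2 * + 2)
  y = solve-∀

Λ-b₁ : ∀ m n → Λ (bₖ m n 1)
Λ-b₁ m n = - n , m , cong₂ _,_ (x m n) (y m n)
  where
  x : ∀ m n → + 2 * - (m + + 2 * n) ≡ (- n) * (+ 2 * + 2) + m * (+ 2 * - + 1)
  x = solve-∀
  y : ∀ m n → + 2 * (+ 2 * m - n) ≡ (- n) * (+ 2 * + 1) + m * (+ 2 * + 2)
  y = solve-∀

Λ-level : ∀ m n k → Λ (aₖ m n k) × Λ (bₖ m n k)
Λ-level m n zero          = Λ-level m n 1
Λ-level m n (suc zero)    = Λ-a₁ m n , Λ-b₁ m n
Λ-level m n (suc (suc k)) with level m n (suc k) | Λ-level m n (suc k)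
... | _ , _ | Λa , Λb = Span-⊕ Λa Λb , Span-⊖ Λb Λa

quarterTurn-centre : ∀ m n → quarterTurn (centre m n) ≡ iso r1 (aₖ m n 1)
quarterTurn-centre m n = cong (iso r1) (cong₂ _,_ (x (M'₁ m n) (N'₁ m n)) (y (M'₁ m n) (N'₁ m n)))
  where
  x : ∀ M N → (M - N) - - (N + M) ≡ + 2 * M
  x = solve-∀
  y : ∀ M N → (N + M) - (M - N) ≡ + 2 * N
  y = solve-∀

G-rotation : ∀ r → G (iso r (+ 0 , + 0))
G-rotation r0 = one
G-rotation r1 = gen qt
G-rotation r2 = mul (gen qt) (gen qt)
G-rotation r3 = mul (gen qt) (mul (gen qt) (gen qt))

G-iso : ∀ r {t} → Λ t → G (iso r t)
G-iso r (p , q , refl) =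
  subst (λ t → G (iso r t)) (cong₂ _,_ (+-identityˡ _) (+-identityˡ _))
    (mul (gen (trn p q)) (G-rotation r))

G'-generators⊆G : ∀ m n k {g} → QTLatticeGens (centre m n) (aₖ m n k) (bₖ m n k) g → G g
G'-generators⊆G m n k qt = subst G (sym (quarterTurn-centre m n)) (G-iso r1 (Λ-a₁ m n))
G'-generators⊆G m n k (trn i j) with Λ-level m n k
... | Λa , Λb = G-iso r0 (Span-⊕ (Span-· i Λa) (Span-· j Λb))

G'⊆G : ∀ m n k {g} → G' m n k g → G g
G'⊆G m n k = ⟨⟩-least (G'-generators⊆G m n k)

theorem3 : (m n : ℤ) → ¬ (+ 2 ∣ (m + n)) →
    (k : ℕ) → 1 ≤ k → k ≤ 4 →
    (g : Iso) → G' m n k g → G g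
theorem3 m n _ k _ _ _ = G'⊆G m n k
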